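{- Let $G\in\mathcal{B}$. Then $5v(G)-3e(G)=1$ and $5v(G)-3e(G)-T^{3}(G)=-1$.
   Context: $v(G)=|V(G)|$, $e(G)=|E(G)|$; $T^{3}(G)$ is the maximum number of pairwise vertex-disjoint triangles in $G$. Ore composition of $H_1,H_2$: delete an edge $xy$ of $H_1$; split a vertex $z$ of $H_2$ into two vertices $z_1,z_2$ of positive degree with $N(z_1)\cup N(z_2)=N(z)$ and $N(z_1)\cap N(z_2)=\emptyset$; identify $x$ with $z_1$ and $y$ with $z_2$. A graph is $4$-Ore if it is $K_4$ or an Ore composition of two $4$-Ore graphs. $T_8$ is the graph on $u_1,\dots,u_8$ with edges $u_1u_2,u_1u_3,u_1u_4,u_1u_5,u_2u_3,u_2u_4,u_2u_5,u_3u_8,u_4u_7,u_5u_6,u_6u_7,u_6u_8,u_7u_8$. $\mathcal{B}$ is the smallest class with $T_8\in\mathcal{B}$ such that whenever $G\in\mathcal{B}$ and $H$ is $4$-Ore, every Ore composition $G'$ of $G$ and $H$ (either as edge side) with $T^{3}(G')=2$ belongs to $\mathcal{B}$. -}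

module Defs where

open import Data.Nat using (ℕ; zero; suc; _+_; _*_; _<ᵇ_; _≡ᵇ_)
open import Data.Bool using (Bool; true; false; _∧_; _∨_; not; if_then_else_)
open import Data.Bool.Properties using (∨-comm)
open import Data.Fin using (Fin; toℕ; _≟_)
open import Data.List using (List; []; _∷_; map; allFin)
open import Data.Nat.ListAction using (sum)
open import Data.Bool.ListAction using (any)
open import Data.Product using (Σ; ∃; _×_; _,_)
open import Data.Sum using (_⊎_)
open import Relation.Nullary using (¬_)
open import Relation.Binary.PropositionalEquality using (_≡_; _≢_; refl)
open import Function.Bundles using (_↔_; _⇔_; Inverse)

record Graph : Set where
  field
    n      : ℕ
    adj    : Fin n → Fin n → Bool
    sym    : ∀ i j → adj i j ≡ adj j i
    irrefl : ∀ i → adj i i ≡ false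
open Graph public

V : Graph → Set
V G = Fin (n G)

vcount : Graph → ℕ
vcount G = n G

ecount : Graph → ℕ
ecount G = sum (map (λ i → sum (map (λ j →
             if (toℕ i <ᵇ toℕ j) ∧ adj G i j then 1 else 0)
             (allFin (n G)))) (allFin (n G)))

record Iso (G H : Graph) : Set where
  field
    bij : V G ↔ V H
    pres : ∀ i j → adj H (Inverse.to bij i) (Inverse.to bij j) ≡ adj G i j

record HasTriangles (G : Graph) (k : ℕ) : Set where
  field
    tri   : Fin k → Fin 3 → V G
    inj   : ∀ i j p q → tri i p ≡ tri j q → (i ≡ j) × (p ≡ q)
    edges : ∀ i p q → p ≢ q → adj G (tri i p) (tri i q) ≡ true

IsT3 : Graph → ℕ → Set
IsT3 G t = HasTriangles G t × ¬ HasTriangles G (suc t)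

-- OreComp H₁ H₂ G : G is (a labelled copy of) an Ore
-- composition of H₁ and H₂: the edge xy of H₁ is deleted, the vertex z
-- of H₂ is split into z₁ (neighbours w with side w = true) and z₂
-- (neighbours with side w = false), both of positive degree, and z₁,z₂
-- are identified with x,y.  φ embeds V(H₁), ψ embeds V(H₂) ∖ {z}.

record OreComp (H₁ H₂ G : Graph) : Set where
  field
    x y   : V H₁
    xy    : adj H₁ x y ≡ true
    z     : V H₂
    side  : V H₂ → Bool
    z₁pos : ∃ λ w → adj H₂ z w ≡ true × side w ≡ true
    z₂pos : ∃ λ w → adj H₂ z w ≡ true × side w ≡ false
    φ     : V H₁ → V G
    ψ     : V H₂ → V G
    φ-inj : ∀ a b → φ a ≡ φ b → a ≡ b
    ψ-inj : ∀ w w' → w ≢ z → w' ≢ z → ψ w ≡ ψ w' → w ≡ w'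
    disj  : ∀ a w → w ≢ z → φ a ≢ ψ w
    cover : ∀ u → (∃ λ a → φ a ≡ u) ⊎ (∃ λ w → w ≢ z × ψ w ≡ u)
    adj-xy : adj G (φ x) (φ y) ≡ false
    adj₁₁ : ∀ a b → ¬ ((a ≡ x × b ≡ y) ⊎ (a ≡ y × b ≡ x)) →
            adj G (φ a) (φ b) ≡ adj H₁ a b
    adj₂₂ : ∀ w w' → w ≢ z → w' ≢ z → adj G (ψ w) (ψ w') ≡ adj H₂ w w'
    adj₁₂ : ∀ a w → w ≢ z →
            (adj G (φ a) (ψ w) ≡ true) ⇔
            (adj H₂ z w ≡ true × ((a ≡ x × side w ≡ true) ⊎ (a ≡ y × side w ≡ false)))

K4adj : Fin 4 → Fin 4 → Bool
K4adj i j = not (toℕ i ≡ᵇ toℕ j)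

K4 : Graph
K4 = record { n = 4 ; adj = K4adj ; sym = s ; irrefl = ir }
  where
  s : ∀ i j → K4adj i j ≡ K4adj j i
  s i j = symᵇ (toℕ i) (toℕ j)
    where
    symᵇ : ∀ a b → not (a ≡ᵇ b) ≡ not (b ≡ᵇ a)
    symᵇ zero zero = refl
    symᵇ zero (suc b) = refl
    symᵇ (suc a) zero = refl
    symᵇ (suc a) (suc b) = symᵇ a b
  ir : ∀ i → K4adj i i ≡ false
  ir Fin.zero = refl
  ir (Fin.suc Fin.zero) = refl
  ir (Fin.suc (Fin.suc Fin.zero)) = refl
  ir (Fin.suc (Fin.suc (Fin.suc Fin.zero))) = refl

data Ore4 : Graph → Set where
  isK4 : ∀ {G} → Iso K4 G → Ore4 G
  comp : ∀ {H₁ H₂ G} → Ore4 H₁ → Ore4 H₂ → OreComp H₁ H₂ G → Ore4 G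

-- T₈ (vertices u₁..u₈ are 0..7)

T8edges : List (ℕ × ℕ)
T8edges = (0 , 1) ∷ (0 , 2) ∷ (0 , 3) ∷ (0 , 4) ∷ (1 , 2) ∷ (1 , 3) ∷ (1 , 4)
        ∷ (2 , 7) ∷ (3 , 6) ∷ (4 , 5) ∷ (5 , 6) ∷ (5 , 7) ∷ (6 , 7) ∷ []

isE : ℕ → ℕ → Bool
isE a b = any (λ { (c , d) → (a ≡ᵇ c) ∧ (b ≡ᵇ d) }) T8edges

T8adj : Fin 8 → Fin 8 → Bool
T8adj i j = isE (toℕ i) (toℕ j) ∨ isE (toℕ j) (toℕ i)

T8 : Graph
T8 = record { n = 8 ; adj = T8adj ; sym = λ i j → ∨-comm (isE (toℕ i) (toℕ j)) _ ; irrefl = ir }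
  where
  open Fin
  ir : ∀ i → T8adj i i ≡ false
  ir zero = refl
  ir (suc zero) = refl
  ir (suc (suc zero)) = refl
  ir (suc (suc (suc zero))) = refl
  ir (suc (suc (suc (suc zero)))) = refl
  ir (suc (suc (suc (suc (suc zero))))) = refl
  ir (suc (suc (suc (suc (suc (suc zero)))))) = refl
  ir (suc (suc (suc (suc (suc (suc (suc zero))))))) = refl

data InB : Graph → Set where
  base  : ∀ {G} → Iso T8 G → InB G
  compL : ∀ {G H G'} → InB G → Ore4 H → OreComp G H G' → IsT3 G' 2 → InB G'
  compR : ∀ {G H G'} → InB G → Ore4 H → OreComp H G G' → IsT3 G' 2 → InB G'

-- An Ore composition of H₁ and H₂ identifies the two ends x, y of the deleted edge of H₁ with the two
-- halves of the split vertex z of H₂, so it has v(H₁) + v(H₂) − 1 vertices, and it loses the edge xy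
-- while every edge at z survives at x or at y, so it has e(H₁) + e(H₂) − 1 edges. Hence the potential
-- 5v − 3e satisfies p(G) = p(H₁) + p(H₂) − 2. Since p(K₄) = 2 and p(T₈) = 1, every 4-Ore graph has
-- potential 2 and every graph of 𝓑 has potential 1. The edge counts are obtained from degree sums,
-- summing over V(G) as V(H₁) followed by V(H₂) ∖ {z}. Finally T³ = 2 on 𝓑: a composition enters 𝓑
-- only with T³ = 2, and T₈ has two disjoint triangles but not three, as each triangle contains u₁ or u₆.
module Submission where

open import Defs hiding (sym)
open import Data.Integer using (ℤ; +_; -[1+_]; _-_)
import Data.Integer as ℤ
open import Data.Integer.Properties using (pos-+)
open import Data.Integer.Tactic.RingSolver using (solve-∀)
open import Data.Nat using (ℕ; zero; suc; _+_; _*_; pred; _<_; _≤_; _<ᵇ_; _<?_)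
open import Data.Nat.ListAction using (sum)
open import Data.Nat.Properties
  using (+-*-semiring; +-identityʳ; +-assoc; +-comm; *-distribˡ-+; *-identityʳ; *-cancelˡ-≡;
         <-cmp; ≤⇒≯; ≤-refl; suc-pred)
import Data.Nat.Tactic.RingSolver as ℕ-Solver
open import Algebra.Properties.Semiring.Sum +-*-semiring
  using (sum-syntax; sum-cong-≗; sum-replicate-zero; sum-remove; ∑-distrib-+; ∑-comm; sum-permute;
         *-distribˡ-sum)
open import Data.Bool using (Bool; true; false; _∧_; if_then_else_)
open import Data.Bool.Properties using (⇔→≡)
import Data.Bool.Properties as Bool
open import Data.Empty using (⊥-elim)
open import Data.Fin using (Fin; zero; suc; toℕ; _↑ˡ_; _↑ʳ_; splitAt; join; punchIn; punchOut; inject≤; _≟_)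
open import Data.Fin.Patterns using (0F; 1F; 2F; 5F; 6F; 7F)
open import Data.Fin.Permutation using (Permutation; _⟨$⟩ʳ_; ↔⇒≡)
open import Data.Fin.Properties
  using (join-splitAt; punchInᵢ≢i; punchIn-injective; punchIn-punchOut; inject≤-injective;
         injective⇒≤; toℕ-injective; nonZeroIndex; all?; any?)
import Data.List as List
open import Data.Product using (_×_; ∃; ∃₂; _,_; proj₁)
open import Data.Sum using (_⊎_; inj₁; inj₂; [_,_]′)
open import Data.Vec.Functional using (Vector; _++_)
open import Data.Vec.Functional.Properties using (lookup-++ˡ; lookup-++ʳ)
open import Function using (_∘_; id; _⇔_; mk⇔; Injective; Surjective; Inverse; Equivalence)
open import Function.Bundles using (mk⤖; Injection)
open import Function.Properties.Bijection using (⤖⇒↔)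
open import Function.Properties.Inverse using (↔-sym; ↔⇒↣)
open import Relation.Binary using (tri<; tri≈; tri>)
open import Relation.Binary.PropositionalEquality
  using (_≡_; _≢_; refl; sym; trans; cong; cong₂; module ≡-Reasoning)
open import Relation.Nullary using (¬_; Dec; yes; no; does; ¬?)
open import Relation.Nullary.Decidable
  using (dec-true; dec-false; toWitness; _×-dec_; _⊎-dec_; _→-dec_)

open ≡-Reasoning

𝟙 : Bool → ℕ
𝟙 b = if b then 1 else 0

𝟙-∧ : ∀ b c → 𝟙 (b ∧ c) ≡ 𝟙 b * 𝟙 c
𝟙-∧ true  c = sym (+-identityʳ (𝟙 c))
𝟙-∧ false c = refl

∧-does-true : ∀ {p} {P : Set p} {b} (P? : Dec P) → (b ∧ does P?) ≡ true ⇔ (b ≡ true × P)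
∧-does-true {b = true}  (yes p) = mk⇔ (λ _ → refl , p) (λ _ → refl)
∧-does-true {b = true}  (no ¬p) = mk⇔ (λ ()) (λ (_ , p) → ⊥-elim (¬p p))
∧-does-true {b = false} P?      = mk⇔ (λ ()) (λ ())

δ : ∀ {n} → Fin n → Fin n → ℕ
δ a b = 𝟙 (does (a ≟ b))

δ-refl : ∀ {n} (a : Fin n) → δ a a ≡ 1
δ-refl a = cong 𝟙 (dec-true (a ≟ a) refl)

δ-≢ : ∀ {n} {a b : Fin n} → a ≢ b → δ a b ≡ 0
δ-≢ {a = a} {b} a≢b = cong 𝟙 (dec-false (a ≟ b) a≢b)

δ*δ-≢ : ∀ {m n} {a x : Fin m} {b y : Fin n} → ¬ (a ≡ x × b ≡ y) → δ a x * δ b y ≡ 0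
δ*δ-≢ {a = a} {x} {b} {y} ne with a ≟ x | b ≟ y
... | no  _   | _       = refl
... | yes _   | no _    = refl
... | yes a≡x | yes b≡y = ⊥-elim (ne (a≡x , b≡y))

-- others z enumerates Fin n ∖ {z}; the index type Fin (pred n) is right because z forces n ≥ 1.
others : ∀ {n} → Fin n → Fin (pred n) → Fin n
others {suc _} = punchIn

others-≢ : ∀ {n} (z : Fin n) k → others z k ≢ z
others-≢ {suc _} = punchInᵢ≢i

others-injective : ∀ {n} (z : Fin n) {k l} → others z k ≡ others z l → k ≡ l
others-injective {suc _} z = punchIn-injective z _ _

others-surjective : ∀ {n} (z : Fin n) {w} → w ≢ z → ∃ λ k → others z k ≡ w
others-surjective {suc _} z w≢z = punchOut (w≢z ∘ sym) , punchIn-punchOut (w≢z ∘ sym)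

∑-others : ∀ {n} (z : Fin n) (f : Fin n → ℕ) →
           ∑[ i < n ] f i ≡ f z + ∑[ k < pred n ] f (others z k)
∑-others {suc _} z f = sum-remove {i = z} f

∑-zero : ∀ n {f : Fin n → ℕ} → (∀ i → f i ≡ 0) → ∑[ i < n ] f i ≡ 0
∑-zero n f≗0 = trans (sum-cong-≗ f≗0) (sum-replicate-zero n)

∑-δ : ∀ {n} (x : Fin n) → ∑[ a < n ] δ a x ≡ 1
∑-δ {n} x = begin
  ∑[ a < n ] δ a x
    ≡⟨ ∑-others x (λ a → δ a x) ⟩
  δ x x + ∑[ k < pred n ] δ (others x k) x
    ≡⟨ cong₂ _+_ (δ-refl x) (∑-zero (pred n) (δ-≢ ∘ others-≢ x)) ⟩
  1
    ∎

∑-scale-δ : ∀ {n} c (x : Fin n) → ∑[ a < n ] (c * δ a x) ≡ c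
∑-scale-δ {n} c x = begin
  ∑[ a < n ] (c * δ a x)  ≡⟨ *-distribˡ-sum c (λ a → δ a x) ⟨
  c * ∑[ a < n ] δ a x    ≡⟨ cong (c *_) (∑-δ x) ⟩
  c * 1                   ≡⟨ *-identityʳ c ⟩
  c                       ∎

∑∑-δ*δ : ∀ {m n} (x : Fin m) (y : Fin n) → ∑[ a < m ] ∑[ b < n ] (δ a x * δ b y) ≡ 1
∑∑-δ*δ x y = trans (sum-cong-≗ λ a → ∑-scale-δ (δ a x) y) (∑-δ x)

∑∑-distrib-+ : ∀ {m n} (f g : Fin m → Fin n → ℕ) →
               ∑[ i < m ] ∑[ j < n ] (f i j + g i j)
               ≡ ∑[ i < m ] ∑[ j < n ] f i j + ∑[ i < m ] ∑[ j < n ] g i j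
∑∑-distrib-+ {n = n} f g = trans (sum-cong-≗ λ i → ∑-distrib-+ (f i) (g i))
                                 (∑-distrib-+ (λ i → ∑[ j < n ] f i j) (λ i → ∑[ j < n ] g i j))

∑-++ : ∀ m n (f : Fin (m + n) → ℕ) →
       ∑[ i < m + n ] f i ≡ ∑[ i < m ] f (i ↑ˡ n) + ∑[ j < n ] f (m ↑ʳ j)
∑-++ zero    n f = refl
∑-++ (suc m) n f = trans (cong₂ _+_ refl (∑-++ m n (f ∘ suc))) (sym (+-assoc (f zero) _ _))

sum-map-tabulate : ∀ {A : Set} n (g : A → ℕ) (h : Fin n → A) →
                   sum (List.map g (List.tabulate h)) ≡ ∑[ i < n ] g (h i)
sum-map-tabulate zero    g h = refl
sum-map-tabulate (suc n) g h = cong₂ _+_ refl (sum-map-tabulate n g (h ∘ suc))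

++-injective-disjoint : ∀ {A : Set} {m n} {u : Vector A m} {v : Vector A n} →
                        Injective _≡_ _≡_ u → Injective _≡_ _≡_ v → (∀ i j → u i ≢ v j) →
                        Injective _≡_ _≡_ (u ++ v)
++-injective-disjoint {m = m} {n} {u} {v} u-inj v-inj disjoint {i} {j} e = begin
  i                          ≡⟨ join-splitAt m n i ⟨
  join m n (splitAt m i)     ≡⟨ cong (join m n) ([,]-injective (splitAt m i) (splitAt m j) e) ⟩
  join m n (splitAt m j)     ≡⟨ join-splitAt m n j ⟩
  j                          ∎
  where
  [,]-injective : ∀ s t → [ u , v ]′ s ≡ [ u , v ]′ t → s ≡ t
  [,]-injective (inj₁ a) (inj₁ b) e = cong inj₁ (u-inj e)
  [,]-injective (inj₁ a) (inj₂ b) e = ⊥-elim (disjoint a b e)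
  [,]-injective (inj₂ a) (inj₁ b) e = ⊥-elim (disjoint b a (sym e))
  [,]-injective (inj₂ a) (inj₂ b) e = cong inj₂ (v-inj e)

-- Degree sums

adjCount : ∀ (G : Graph) {k m} → Vector (V G) k → Vector (V G) m → ℕ
adjCount G {k} {m} u v = ∑[ i < k ] ∑[ j < m ] 𝟙 (adj G (u i) (v j))

degreeSum : Graph → ℕ
degreeSum G = adjCount G id id

degree : (G : Graph) → V G → ℕ
degree G v = ∑[ w < n G ] 𝟙 (adj G v w)

adjCount-comm : ∀ G {k m} (u : Vector (V G) k) (v : Vector (V G) m) → adjCount G u v ≡ adjCount G v u
adjCount-comm G u v = trans (∑-comm (λ i j → 𝟙 (adj G (u i) (v j))))
                            (sum-cong-≗ λ j → sum-cong-≗ λ i → cong 𝟙 (Graph.sym G (u i) (v j)))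

adjCount-++ˡ : ∀ G {k k′ m} (u : Vector (V G) k) (u′ : Vector (V G) k′) (v : Vector (V G) m) →
               adjCount G (u ++ u′) v ≡ adjCount G u v + adjCount G u′ v
adjCount-++ˡ G {k} {k′} u u′ v = trans (∑-++ k k′ _) (cong₂ _+_
  (sum-cong-≗ λ i → sum-cong-≗ λ j → cong (λ a → 𝟙 (adj G a (v j))) (lookup-++ˡ u u′ i))
  (sum-cong-≗ λ i → sum-cong-≗ λ j → cong (λ a → 𝟙 (adj G a (v j))) (lookup-++ʳ u u′ i)))

adjCount-++ʳ : ∀ G {k m m′} (u : Vector (V G) k) (v : Vector (V G) m) (v′ : Vector (V G) m′) →
               adjCount G u (v ++ v′) ≡ adjCount G u v + adjCount G u v′
adjCount-++ʳ G {k} {m} {m′} u v v′ = trans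
  (sum-cong-≗ λ i → trans (∑-++ m m′ _) (cong₂ _+_
    (sum-cong-≗ λ j → cong (λ b → 𝟙 (adj G (u i) b)) (lookup-++ˡ v v′ j))
    (sum-cong-≗ λ j → cong (λ b → 𝟙 (adj G (u i) b)) (lookup-++ʳ v v′ j))))
  (∑-distrib-+ (λ i → ∑[ j < m ] 𝟙 (adj G (u i) (v j)))
               (λ i → ∑[ j < m′ ] 𝟙 (adj G (u i) (v′ j))))

adjCount-++ : ∀ G {k k′} (u : Vector (V G) k) (u′ : Vector (V G) k′) →
              adjCount G (u ++ u′) (u ++ u′)
              ≡ (adjCount G u u + adjCount G u u′) + (adjCount G u′ u + adjCount G u′ u′)
adjCount-++ G u u′ = trans (adjCount-++ˡ G u u′ (u ++ u′))
                           (cong₂ _+_ (adjCount-++ʳ G u u u′) (adjCount-++ʳ G u′ u u′))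

adjCount-permute : ∀ G {m} (π : Permutation m (n G)) → adjCount G (π ⟨$⟩ʳ_) (π ⟨$⟩ʳ_) ≡ degreeSum G
adjCount-permute G {m} π = sym (trans (sum-cong-≗ λ u → sum-permute (λ v → 𝟙 (adj G u v)) π)
                                      (sum-permute (λ u → ∑[ j < m ] 𝟙 (adj G u (π ⟨$⟩ʳ j))) π))

degree-others : ∀ G (z : V G) → degree G z ≡ ∑[ k < pred (n G) ] 𝟙 (adj G z (others z k))
degree-others G z = trans (∑-others z (λ w → 𝟙 (adj G z w)))
                          (cong (λ b → 𝟙 b + ∑[ k < pred (n G) ] 𝟙 (adj G z (others z k))) (irrefl G z))

degreeSum-others : ∀ G (z : V G) →
                   degreeSum G ≡ degree G z + (degree G z + adjCount G (others z) (others z))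
degreeSum-others G z = begin
  degreeSum G
    ≡⟨ ∑-others z (λ u → ∑[ v < n G ] 𝟙 (adj G u v)) ⟩
  degree G z + ∑[ k < m ] ∑[ v < n G ] 𝟙 (adj G (others z k) v)
    ≡⟨ cong₂ _+_ refl (sum-cong-≗ λ k → ∑-others z (λ v → 𝟙 (adj G (others z k) v))) ⟩
  degree G z + ∑[ k < m ] (𝟙 (adj G (others z k) z) + ∑[ l < m ] 𝟙 (adj G (others z k) (others z l)))
    ≡⟨ cong₂ _+_ refl (∑-distrib-+ (λ k → 𝟙 (adj G (others z k) z))
                                   (λ k → ∑[ l < m ] 𝟙 (adj G (others z k) (others z l)))) ⟩
  degree G z + (∑[ k < m ] 𝟙 (adj G (others z k) z) + adjCount G (others z) (others z))
    ≡⟨ cong (λ d → degree G z + (d + adjCount G (others z) (others z))) (begin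
         ∑[ k < m ] 𝟙 (adj G (others z k) z)  ≡⟨ sum-cong-≗ (λ k → cong 𝟙 (Graph.sym G (others z k) z)) ⟩
         ∑[ k < m ] 𝟙 (adj G z (others z k))  ≡⟨ degree-others G z ⟨
         degree G z                           ∎) ⟩
  degree G z + (degree G z + adjCount G (others z) (others z))
    ∎
  where m = pred (n G)

upperAdj : (G : Graph) → V G → V G → ℕ
upperAdj G i j = 𝟙 ((toℕ i <ᵇ toℕ j) ∧ adj G i j)

ecount-∑ : ∀ G → ecount G ≡ ∑[ i < n G ] ∑[ j < n G ] upperAdj G i j
ecount-∑ G = trans (sum-map-tabulate (n G) row id) (sum-cong-≗ λ i → sum-map-tabulate (n G) (upperAdj G i) id)
  where
  row : V G → ℕ
  row i = sum (List.map (upperAdj G i) (List.allFin (n G)))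

<ᵇ-true : ∀ {a b} → a < b → (a <ᵇ b) ≡ true
<ᵇ-true = dec-true (_ <? _)

<ᵇ-false : ∀ {a b} → ¬ a < b → (a <ᵇ b) ≡ false
<ᵇ-false = dec-false (_ <? _)

adj-split : ∀ G (i j : V G) → 𝟙 (adj G i j) ≡ upperAdj G i j + upperAdj G j i
adj-split G i j with <-cmp (toℕ i) (toℕ j)
... | tri< i<j _ j≮i rewrite <ᵇ-true i<j | <ᵇ-false j≮i = sym (+-identityʳ _)
... | tri> i≮j _ j<i rewrite <ᵇ-true j<i | <ᵇ-false i≮j = cong 𝟙 (Graph.sym G i j)
... | tri≈ i≮j i≡j _ rewrite toℕ-injective i≡j | irrefl G j | <ᵇ-false i≮j = refl

handshake : ∀ G → degreeSum G ≡ 2 * ecount G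
handshake G = begin
  degreeSum G
    ≡⟨ sum-cong-≗ (λ i → sum-cong-≗ (adj-split G i)) ⟩
  ∑[ i < n G ] ∑[ j < n G ] (upperAdj G i j + upperAdj G j i)
    ≡⟨ ∑∑-distrib-+ (upperAdj G) (λ i j → upperAdj G j i) ⟩
  ∑[ i < n G ] ∑[ j < n G ] upperAdj G i j + ∑[ i < n G ] ∑[ j < n G ] upperAdj G j i
    ≡⟨ cong₂ _+_ refl (∑-comm λ i j → upperAdj G j i) ⟩
  ∑[ i < n G ] ∑[ j < n G ] upperAdj G i j + ∑[ j < n G ] ∑[ i < n G ] upperAdj G j i
    ≡⟨ cong (λ e → e + e) (ecount-∑ G) ⟨
  ecount G + ecount G
    ≡⟨ cong₂ _+_ refl (+-identityʳ (ecount G)) ⟨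
  2 * ecount G
    ∎

module _ {H G : Graph} (I : Iso H G) where
  open Iso I

  vcount-iso : vcount H ≡ vcount G
  vcount-iso = ↔⇒≡ bij

  degreeSum-iso : degreeSum H ≡ degreeSum G
  degreeSum-iso = trans (sum-cong-≗ λ i → sum-cong-≗ λ j → cong 𝟙 (sym (pres i j)))
                        (adjCount-permute G bij)

  ecount-iso : ecount H ≡ ecount G
  ecount-iso = *-cancelˡ-≡ _ _ 2 (trans (sym (handshake H)) (trans degreeSum-iso (handshake G)))

-- Counting vertices and edges of an Ore composition

module OreCounts {H₁ H₂ G : Graph} (O : OreComp H₁ H₂ G) where
  open OreComp O

  x≢y : x ≢ y
  x≢y refl with trans (sym (irrefl H₁ x)) xy
  ... | ()

  ψ∖z : Vector (V G) (pred (n H₂))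
  ψ∖z = ψ ∘ others z

  merge : Vector (V G) (n H₁ + pred (n H₂))
  merge = φ ++ ψ∖z

  merge-injective : Injective _≡_ _≡_ merge
  merge-injective = ++-injective-disjoint (φ-inj _ _)
    (others-injective z ∘ ψ-inj _ _ (others-≢ z _) (others-≢ z _))
    (λ a k → disj a (others z k) (others-≢ z k))

  merge-surjective : Surjective _≡_ _≡_ merge
  merge-surjective u with cover u
  ... | inj₁ (a , φa≡u) = a ↑ˡ _ , λ { refl → trans (lookup-++ˡ φ ψ∖z a) φa≡u }
  ... | inj₂ (w , w≢z , ψw≡u) with others-surjective z w≢z
  ...   | k , refl = n H₁ ↑ʳ k , λ { refl → trans (lookup-++ʳ φ ψ∖z k) ψw≡u }

  merge-perm : Permutation (n H₁ + pred (n H₂)) (n G)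
  merge-perm = ⤖⇒↔ (mk⤖ (merge-injective , merge-surjective))

  vcount-ore : vcount G + 1 ≡ vcount H₁ + vcount H₂
  vcount-ore = begin
    n G + 1                   ≡⟨ cong (_+ 1) (↔⇒≡ merge-perm) ⟨
    n H₁ + pred (n H₂) + 1    ≡⟨ +-assoc (n H₁) (pred (n H₂)) 1 ⟩
    n H₁ + (pred (n H₂) + 1)  ≡⟨ cong₂ _+_ refl (+-comm (pred (n H₂)) 1) ⟩
    n H₁ + suc (pred (n H₂))  ≡⟨ cong₂ _+_ refl (suc-pred (n H₂) ⦃ nonZeroIndex z ⦄) ⟩
    n H₁ + n H₂               ∎

  xy-pairs : V H₁ → V H₁ → ℕ
  xy-pairs a b = δ a x * δ b y + δ a y * δ b x

  adj-φφ : ∀ a b → 𝟙 (adj H₁ a b) ≡ 𝟙 (adj G (φ a) (φ b)) + xy-pairs a b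
  adj-φφ a b with (a ≟ x ×-dec b ≟ y) ⊎-dec (a ≟ y ×-dec b ≟ x)
  ... | yes (inj₁ (refl , refl))
    rewrite xy | adj-xy | δ-refl x | δ-refl y | δ-≢ x≢y = refl
  ... | yes (inj₂ (refl , refl))
    rewrite Graph.sym H₁ y x | xy | Graph.sym G (φ y) (φ x) | adj-xy
          | δ-refl x | δ-refl y | δ-≢ (x≢y ∘ sym) = refl
  ... | no ¬xy = begin
    𝟙 (adj H₁ a b)
      ≡⟨ cong 𝟙 (adj₁₁ a b ¬xy) ⟨
    𝟙 (adj G (φ a) (φ b))
      ≡⟨ +-identityʳ _ ⟨
    𝟙 (adj G (φ a) (φ b)) + 0
      ≡⟨ cong₂ _+_ refl (cong₂ _+_ (δ*δ-≢ (¬xy ∘ inj₁)) (δ*δ-≢ (¬xy ∘ inj₂))) ⟨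
    𝟙 (adj G (φ a) (φ b)) + xy-pairs a b
      ∎

  deleted-edge : adjCount G φ φ + 2 ≡ degreeSum H₁
  deleted-edge = sym (begin
    degreeSum H₁
      ≡⟨ sum-cong-≗ (λ a → sum-cong-≗ (adj-φφ a)) ⟩
    ∑[ a < n H₁ ] ∑[ b < n H₁ ] (𝟙 (adj G (φ a) (φ b)) + xy-pairs a b)
      ≡⟨ ∑∑-distrib-+ (λ a b → 𝟙 (adj G (φ a) (φ b))) xy-pairs ⟩
    adjCount G φ φ + ∑[ a < n H₁ ] ∑[ b < n H₁ ] xy-pairs a b
      ≡⟨ cong₂ _+_ refl (∑∑-distrib-+ (λ a b → δ a x * δ b y) (λ a b → δ a y * δ b x)) ⟩
    adjCount G φ φ + (∑[ a < n H₁ ] ∑[ b < n H₁ ] (δ a x * δ b y)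
                      + ∑[ a < n H₁ ] ∑[ b < n H₁ ] (δ a y * δ b x))
      ≡⟨ cong₂ _+_ refl (cong₂ _+_ (∑∑-δ*δ x y) (∑∑-δ*δ y x)) ⟩
    adjCount G φ φ + 2
      ∎)

  -- The end of the deleted edge xy to which an edge zw of H₂ is transferred.
  endpoint : Bool → V H₁
  endpoint true  = x
  endpoint false = y

  attaches : ∀ a w → ((a ≡ x × side w ≡ true) ⊎ (a ≡ y × side w ≡ false)) ⇔ a ≡ endpoint (side w)
  attaches a w with side w
  ... | true  = mk⇔ (λ { (inj₁ (e , _)) → e ; (inj₂ (_ , ())) }) (λ e → inj₁ (e , refl))
  ... | false = mk⇔ (λ { (inj₁ (_ , ())) ; (inj₂ (e , _)) → e }) (λ e → inj₂ (e , refl))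

  adj-φψ : ∀ a w → w ≢ z → adj G (φ a) (ψ w) ≡ (adj H₂ z w ∧ does (a ≟ endpoint (side w)))
  adj-φψ a w w≢z = ⇔→≡ {z = true} (mk⇔
    (λ e → let zw , at = to (adj₁₂ a w w≢z) e
           in from (∧-does-true a≟e) (zw , to (attaches a w) at))
    (λ e → let zw , a≡e = to (∧-does-true a≟e) e
           in from (adj₁₂ a w w≢z) (zw , from (attaches a w) a≡e)))
    where
    open Equivalence
    a≟e = a ≟ endpoint (side w)

  φ-neighbours : ∀ w → w ≢ z → ∑[ a < n H₁ ] 𝟙 (adj G (φ a) (ψ w)) ≡ 𝟙 (adj H₂ z w)
  φ-neighbours w w≢z = trans
    (sum-cong-≗ λ a → trans (cong 𝟙 (adj-φψ a w w≢z)) (𝟙-∧ (adj H₂ z w) _))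
    (∑-scale-δ (𝟙 (adj H₂ z w)) (endpoint (side w)))

  transferred-edges : adjCount G φ ψ∖z ≡ degree H₂ z
  transferred-edges = begin
    adjCount G φ ψ∖z
      ≡⟨ ∑-comm (λ a k → 𝟙 (adj G (φ a) (ψ∖z k))) ⟩
    ∑[ k < pred (n H₂) ] ∑[ a < n H₁ ] 𝟙 (adj G (φ a) (ψ∖z k))
      ≡⟨ sum-cong-≗ (λ k → φ-neighbours (others z k) (others-≢ z k)) ⟩
    ∑[ k < pred (n H₂) ] 𝟙 (adj H₂ z (others z k))
      ≡⟨ degree-others H₂ z ⟨
    degree H₂ z
      ∎

  kept-edges : adjCount G ψ∖z ψ∖z ≡ adjCount H₂ (others z) (others z)
  kept-edges = sum-cong-≗ λ k → sum-cong-≗ λ l →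
    cong 𝟙 (adj₂₂ (others z k) (others z l) (others-≢ z k) (others-≢ z l))

  degreeSum-ore : degreeSum G + 2 ≡ degreeSum H₁ + degreeSum H₂
  degreeSum-ore = begin
    degreeSum G + 2
      ≡⟨ cong (_+ 2) (trans (sym (adjCount-permute G merge-perm)) (adjCount-++ G φ ψ∖z)) ⟩
    (adjCount G φ φ + d) + (adjCount G ψ∖z φ + adjCount G ψ∖z ψ∖z) + 2
      ≡⟨ cong (λ c → (adjCount G φ φ + d) + (c + adjCount G ψ∖z ψ∖z) + 2) (adjCount-comm G ψ∖z φ) ⟩
    (adjCount G φ φ + d) + (d + adjCount G ψ∖z ψ∖z) + 2
      ≡⟨ rearrange (adjCount G φ φ) d (adjCount G ψ∖z ψ∖z) ⟩
    (adjCount G φ φ + 2) + (d + (d + adjCount G ψ∖z ψ∖z))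
      ≡⟨ cong₂ _+_ deleted-edge (cong₂ (λ c e → c + (c + e)) transferred-edges kept-edges) ⟩
    degreeSum H₁ + (degree H₂ z + (degree H₂ z + adjCount H₂ (others z) (others z)))
      ≡⟨ cong₂ _+_ refl (degreeSum-others H₂ z) ⟨
    degreeSum H₁ + degreeSum H₂
      ∎
    where
    d = adjCount G φ ψ∖z
    rearrange : ∀ a d b → (a + d) + (d + b) + 2 ≡ (a + 2) + (d + (d + b))
    rearrange = ℕ-Solver.solve-∀

  ecount-ore : ecount G + 1 ≡ ecount H₁ + ecount H₂
  ecount-ore = *-cancelˡ-≡ _ _ 2 (begin
    2 * (ecount G + 1)             ≡⟨ *-distribˡ-+ 2 (ecount G) 1 ⟩
    2 * ecount G + 2               ≡⟨ cong (_+ 2) (handshake G) ⟨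
    degreeSum G + 2                ≡⟨ degreeSum-ore ⟩
    degreeSum H₁ + degreeSum H₂    ≡⟨ cong₂ _+_ (handshake H₁) (handshake H₂) ⟩
    2 * ecount H₁ + 2 * ecount H₂  ≡⟨ *-distribˡ-+ 2 (ecount H₁) (ecount H₂) ⟨
    2 * (ecount H₁ + ecount H₂)    ∎)

-- Disjoint triangles

Iso-sym : ∀ {H G} → Iso H G → Iso G H
Iso-sym {H} {G} I = record
  { bij  = ↔-sym bij
  ; pres = λ i j → trans (sym (pres (from i) (from j)))
                         (cong₂ (adj G) (Inverse.strictlyInverseˡ bij i) (Inverse.strictlyInverseˡ bij j))
  }
  where
  open Iso I
  from = Inverse.from bij

HasTriangles-iso : ∀ {H G k} → Iso H G → HasTriangles H k → HasTriangles G k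
HasTriangles-iso I T = record
  { tri   = λ i p → to (tri i p)
  ; inj   = λ i j p q e → inj i j p q (Injection.injective (↔⇒↣ bij) e)
  ; edges = λ i p q p≢q → trans (pres (tri i p) (tri i q)) (edges i p q p≢q)
  }
  where
  open Iso I
  open HasTriangles T
  to = Inverse.to bij

IsT3-iso : ∀ {H G t} → Iso H G → IsT3 H t → IsT3 G t
IsT3-iso I (T , ¬T) = HasTriangles-iso I T , ¬T ∘ HasTriangles-iso (Iso-sym I)

HasTriangles-≤ : ∀ {G k m} → k ≤ m → HasTriangles G m → HasTriangles G k
HasTriangles-≤ k≤m T = record
  { tri   = λ i → tri (inject≤ i k≤m)
  ; inj   = λ i j p q e → let i≡j , p≡q = inj _ _ p q e in inject≤-injective k≤m k≤m i j i≡j , p≡q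
  ; edges = λ i → edges (inject≤ i k≤m)
  }
  where open HasTriangles T

IsT3-unique : ∀ {G s t} → IsT3 G s → IsT3 G t → s ≡ t
IsT3-unique (Tₛ , ¬Tₛ₊₁) (Tₜ , ¬Tₜ₊₁) with <-cmp _ _
... | tri< s<t _ _ = ⊥-elim (¬Tₛ₊₁ (HasTriangles-≤ s<t Tₜ))
... | tri≈ _ s≡t _ = s≡t
... | tri> _ _ t<s = ⊥-elim (¬Tₜ₊₁ (HasTriangles-≤ t<s Tₛ))

Transversal : (G : Graph) {s : ℕ} → (Fin s → V G) → Set
Transversal G cover = ∀ a b c → adj G a b ≡ true → adj G b c ≡ true → adj G a c ≡ true →
                      ∃ λ j → cover j ≡ a ⊎ cover j ≡ b ⊎ cover j ≡ c

-- Disjoint triangles meet the transversal in distinct vertices.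
HasTriangles-≤-Transversal : ∀ {G k s} (cover : Fin s → V G) → Transversal G cover →
                             HasTriangles G k → k ≤ s
HasTriangles-≤-Transversal cover meets T = injective⇒≤ hit-injective
  where
  open HasTriangles T
  hit : ∀ i → ∃₂ λ j p → cover j ≡ tri i p
  hit i with meets (tri i 0F) (tri i 1F) (tri i 2F) (edges i 0F 1F λ ()) (edges i 1F 2F λ ()) (edges i 0F 2F λ ())
  ... | j , inj₁ e        = j , 0F , e
  ... | j , inj₂ (inj₁ e) = j , 1F , e
  ... | j , inj₂ (inj₂ e) = j , 2F , e
  hit-injective : Injective _≡_ _≡_ (proj₁ ∘ hit)
  hit-injective {i} {i′} e with hit i | hit i′
  ... | j , p , cj≡tip | j′ , p′ , cj′≡ti′p′ =
    proj₁ (inj i i′ p p′ (trans (sym cj≡tip) (trans (cong cover e) cj′≡ti′p′)))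

T8-triangle : Fin 2 → Fin 3 → Fin 8
T8-triangle 0F 0F = 0F
T8-triangle 0F 1F = 1F
T8-triangle 0F 2F = 2F
T8-triangle 1F 0F = 5F
T8-triangle 1F 1F = 6F
T8-triangle 1F 2F = 7F

T8-hub : Fin 2 → Fin 8
T8-hub 0F = 0F
T8-hub 1F = 5F

T8-two-triangles : HasTriangles T8 2
T8-two-triangles = record
  { tri   = T8-triangle
  ; inj   = toWitness {a? = all? λ i → all? λ j → all? λ p → all? λ q →
                               (T8-triangle i p ≟ T8-triangle j q) →-dec (i ≟ j ×-dec p ≟ q)} _
  ; edges = toWitness {a? = all? λ i → all? λ p → all? λ q →
                               ¬? (p ≟ q) →-dec (T8adj (T8-triangle i p) (T8-triangle i q) Bool.≟ true)} _
  }

T8-hub-Transversal : Transversal T8 T8-hub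
T8-hub-Transversal = toWitness {a? = all? λ a → all? λ b → all? λ c →
  (T8adj a b Bool.≟ true) →-dec (T8adj b c Bool.≟ true) →-dec (T8adj a c Bool.≟ true) →-dec
  any? λ j → (T8-hub j ≟ a) ⊎-dec (T8-hub j ≟ b) ⊎-dec (T8-hub j ≟ c)} _

T8-T3 : IsT3 T8 2
T8-T3 = T8-two-triangles , λ T → ≤⇒≯ (HasTriangles-≤-Transversal T8-hub T8-hub-Transversal T) ≤-refl

-- The potential 5v − 3e

potential : Graph → ℤ
potential G = + (5 * vcount G) - + (3 * ecount G)

potential-iso : ∀ {H G} → Iso H G → potential H ≡ potential G
potential-iso I = cong₂ (λ v e → + (5 * v) - + (3 * e)) (vcount-iso I) (ecount-iso I)

potential-ore : ∀ {H₁ H₂ G} → OreComp H₁ H₂ G → potential G ≡ potential H₁ ℤ.+ potential H₂ - + 2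
potential-ore {H₁} {H₂} {G} O = begin
  a - c                              ≡⟨ shift a c ⟩
  (a ℤ.+ + 5) - (c ℤ.+ + 3) - + 2    ≡⟨ cong₂ (λ p q → p - q - + 2)
                                              (scaled 5 (vcount G) (vcount H₁) (vcount H₂) vcount-ore)
                                              (scaled 3 (ecount G) (ecount H₁) (ecount H₂) ecount-ore) ⟩
  (b₁ ℤ.+ b₂) - (d₁ ℤ.+ d₂) - + 2    ≡⟨ regroup b₁ b₂ d₁ d₂ ⟩
  (b₁ - d₁) ℤ.+ (b₂ - d₂) - + 2      ∎
  where
  open OreCounts O
  a = + (5 * vcount G)
  c = + (3 * ecount G)
  b₁ = + (5 * vcount H₁)
  b₂ = + (5 * vcount H₂)
  d₁ = + (3 * ecount H₁)
  d₂ = + (3 * ecount H₂)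
  scaled : ∀ k u v w → u + 1 ≡ v + w → + (k * u) ℤ.+ + k ≡ + (k * v) ℤ.+ + (k * w)
  scaled k u v w e = begin
    + (k * u) ℤ.+ + k        ≡⟨ pos-+ (k * u) k ⟨
    + (k * u + k)            ≡⟨ cong (λ t → + (k * u + t)) (*-identityʳ k) ⟨
    + (k * u + k * 1)        ≡⟨ cong +_ (*-distribˡ-+ k u 1) ⟨
    + (k * (u + 1))          ≡⟨ cong (λ t → + (k * t)) e ⟩
    + (k * (v + w))          ≡⟨ cong +_ (*-distribˡ-+ k v w) ⟩
    + (k * v + k * w)        ≡⟨ pos-+ (k * v) (k * w) ⟩
    + (k * v) ℤ.+ + (k * w)  ∎
  shift : ∀ a c → a - c ≡ (a ℤ.+ + 5) - (c ℤ.+ + 3) - + 2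
  shift = solve-∀
  regroup : ∀ b₁ b₂ d₁ d₂ →
            (b₁ ℤ.+ b₂) - (d₁ ℤ.+ d₂) - + 2 ≡ (b₁ - d₁) ℤ.+ (b₂ - d₂) - + 2
  regroup = solve-∀

potential-Ore4 : ∀ {H} → Ore4 H → potential H ≡ + 2
potential-Ore4 (isK4 I)       = sym (potential-iso I)
potential-Ore4 (comp H₁ H₂ O) =
  trans (potential-ore O) (cong₂ (λ p q → p ℤ.+ q - + 2) (potential-Ore4 H₁) (potential-Ore4 H₂))

potential-InB : ∀ {G} → InB G → potential G ≡ + 1
potential-InB (base I)        = sym (potential-iso I)
potential-InB (compL G H O _) =
  trans (potential-ore O) (cong₂ (λ p q → p ℤ.+ q - + 2) (potential-InB G) (potential-Ore4 H))
potential-InB (compR G H O _) =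
  trans (potential-ore O) (cong₂ (λ p q → p ℤ.+ q - + 2) (potential-Ore4 H) (potential-InB G))

IsT3-InB : ∀ {G} → InB G → IsT3 G 2
IsT3-InB (base I)         = IsT3-iso I T8-T3
IsT3-InB (compL _ _ _ T3) = T3
IsT3-InB (compR _ _ _ T3) = T3

corollary3p2 : ∀ (G : Graph) → InB G →
    ((+ (5 * vcount G) - + (3 * ecount G)) ≡ + 1)
    × (∀ t → IsT3 G t → (+ (5 * vcount G) - + (3 * ecount G) - + t) ≡ -[1+ 0 ])
corollary3p2 G G∈B =
  potential-InB G∈B ,
  λ t T3 → cong₂ (λ p s → p - + s) (potential-InB G∈B) (IsT3-unique T3 (IsT3-InB G∈B))
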